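{- Let $\mathcal F=\langle W,\leq,R\rangle$ be a birelational frame satisfying the condition $\mathsf{BEM}$: for all $x,y,z\in W$, if $x\leq y$ and $xRz$ then $yRz$. Then $\mathcal F\models\Box\varphi\vee\neg\Box\varphi$ for every $\varphi\in\mathsf{Form}_\Box$, i.e., for every monotone valuation on $\mathcal F$ and every $x\in W$, $x\Vdash\Box\varphi\vee\neg\Box\varphi$.
   Context: The modal language $\mathsf{Form}_\Box$ is generated by $\top$, $\bot$, propositional variables, $\wedge,\vee,\to$ and $\Box$; $\neg\varphi$ abbreviates $\varphi\to\bot$. A birelational frame is $\langle W,\leq,R\rangle$ where $W\ne\emptyset$, $\leq$ is a partial order on $W$, $R\subseteq W\times W$, and for all $x,y,z$: $x\leq y$ and $yRz$ imply $xRz$. A birelational model adds a valuation $V:W\to\mathcal P(\mathsf{Prop})$ monotone in $\leq$ ($x\leq y\Rightarrow V(x)\subseteq V(y)$). Forcing: $x\Vdash p$ iff $p\in V(x)$; $x\nVdash\bot$; $\wedge,\vee$ pointwise; $x\Vdash\varphi\to\psi$ iff for all $y\geq x$, $y\Vdash\varphi$ implies $y\Vdash\psi$; $x\Vdash\Box\varphi$ iff for all $y$ with $xRy$, $y\Vdash\varphi$. -}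

module Defs where

open import Data.Nat using (ℕ)
open import Data.Empty using (⊥)
open import Data.Unit using (⊤)
open import Data.Product using (_×_)
open import Data.Sum using (_⊎_)
open import Relation.Binary.PropositionalEquality using (_≡_)
open import Relation.Binary.Structures using (IsPartialOrder)

Prop : Set
Prop = ℕ

data Form : Set where
  ⊤'  : Form
  ⊥'  : Form
  var : Prop → Form
  _∧'_ : Form → Form → Form
  _∨'_ : Form → Form → Form
  _⇒'_ : Form → Form → Form
  □_  : Form → Form

¬'_ : Form → Form
¬' φ = φ ⇒' ⊥'

record Frame : Set₁ where
  field
    W      : Set
    inhabitant : W
    _≤_    : W → W → Set
    isPO   : IsPartialOrder _≡_ _≤_
    R      : W → W → Set
    ≤R⊆R   : ∀ {x y z} → x ≤ y → R y z → R x z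

record Valuation (F : Frame) : Set₁ where
  open Frame F
  field
    V    : W → Prop → Set
    mono : ∀ {x y p} → x ≤ y → V x p → V y p

BEM : Frame → Set
BEM F = ∀ {x y z} → x ≤ y → R x z → R y z
  where open Frame F

module _ (F : Frame) (M : Valuation F) where
  open Frame F
  open Valuation M

  _⊩_ : W → Form → Set
  x ⊩ ⊤'      = ⊤
  x ⊩ ⊥'      = ⊥
  x ⊩ var p   = V x p
  x ⊩ (φ ∧' ψ) = (x ⊩ φ) × (x ⊩ ψ)
  x ⊩ (φ ∨' ψ) = (x ⊩ φ) ⊎ (x ⊩ ψ)
  x ⊩ (φ ⇒' ψ) = ∀ y → x ≤ y → y ⊩ φ → y ⊩ ψ
  x ⊩ (□ φ)   = ∀ y → R x y → y ⊩ φ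

_⊨_ : Frame → Form → Set₁
F ⊨ φ = (M : Valuation F) → ∀ x → _⊩_ F M x φ

-- Classical metatheory (the paper reasons classically): excluded middle for Set.
open import Relation.Nullary using (Dec)
ExcludedMiddle : Set₁
ExcludedMiddle = (P : Set) → Dec P

{-# OPTIONS --safe #-}
module Submission where

open import Defs
open import Data.Sum using (inj₁; inj₂)
open import Relation.Nullary using (¬_; yes; no; contradiction)

-- BEM makes R x ⊆ R y for x ≤ y, so forcing of □φ is antitone along ≤.
-- For an antitone ψ, failure of ψ at x persists to every y ≥ x, which is
-- exactly x ⊩ ¬ψ; excluded middle at x then gives ψ ∨ ¬ψ.

module _ (F : Frame) (M : Valuation F) where
  open Frame F

  private
    _⊩'_ : W → Form → Set
    _⊩'_ = _⊩_ F M

  Antitone : Form → Set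
  Antitone ψ = ∀ {x y} → x ≤ y → y ⊩' ψ → x ⊩' ψ

  □-antitone : BEM F → ∀ φ → Antitone (□ φ)
  □-antitone bem φ x≤y y⊩□φ z xRz = y⊩□φ z (bem x≤y xRz)

  ¬'-intro-antitone : ∀ ψ → Antitone ψ → ∀ {x} → ¬ (x ⊩' ψ) → x ⊩' (¬' ψ)
  ¬'-intro-antitone ψ antitone x⊮ψ y x≤y y⊩ψ = contradiction (antitone x≤y y⊩ψ) x⊮ψ

  excluded-middle-antitone : ExcludedMiddle → ∀ ψ → Antitone ψ → ∀ x → x ⊩' (ψ ∨' (¬' ψ))
  excluded-middle-antitone em ψ antitone x with em (x ⊩' ψ)
  ... | yes x⊩ψ = inj₁ x⊩ψ
  ... | no  x⊮ψ = inj₂ (¬'-intro-antitone ψ antitone x⊮ψ)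

lemma3p1p6 : ExcludedMiddle → (F : Frame) → BEM F → (φ : Form) → F ⊨ ((□ φ) ∨' (¬' (□ φ)))
lemma3p1p6 em F bem φ M = excluded-middle-antitone F M em (□ φ) (□-antitone F M bem φ)
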